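{- For every integer $n\ge 1$, $N'(n,1,n-1)=n$.
   Context: $\mathbb{Z}_4$ is the ring of integers modulo $4$; a $\mathbb{Z}_4$-code of length $n$ is a $\mathbb{Z}_4$-submodule of $\mathbb{Z}_4^n$. A code has type $4^{k_1}2^{k_2}$ if it is isomorphic as an abelian group to $\mathbb{Z}_4^{k_1}\times\mathbb{Z}_2^{k_2}$. Two codes of the same length are equivalent if one is obtained from the other by permuting coordinates and changing signs of some coordinates. The trivial extension of a code $C$ of length $n-1$ is $\{(c,0)\mid c\in C\}$ (for $n-1=0$, the only code is the zero module). $N'(n,k_1,k_2)$ denotes the number of equivalence classes of $\mathbb{Z}_4$-codes of length $n$ and type $4^{k_1}2^{k_2}$ none of whose members is equivalent to the trivial extension of a $\mathbb{Z}_4$-code of length $n-1$. -}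

module Defs where

open import Data.Nat using (ℕ; zero; suc; _+_; _*_; _∸_)
open import Data.Nat.DivMod using (_mod_)
open import Data.Fin using (Fin; toℕ; zero; suc)
open import Data.Vec using (Vec; []; _∷_; zipWith; map; replicate; tabulate; lookup; last; init)
open import Data.Bool using (Bool; true; false; if_then_else_)
open import Data.Product using (Σ; ∃; ∃-syntax; _×_; _,_)
open import Data.Fin.Permutation using (Permutation′; _⟨$⟩ʳ_)
open import Relation.Binary.PropositionalEquality using (_≡_; _≢_)
open import Relation.Nullary using (¬_)
open import Function.Bundles using (_⇔_)

ℤ₄ : Set
ℤ₄ = Fin 4

ℤ₂ : Set
ℤ₂ = Fin 2

_+₄_ : ℤ₄ → ℤ₄ → ℤ₄
a +₄ b = (toℕ a + toℕ b) mod 4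

_*₄_ : ℤ₄ → ℤ₄ → ℤ₄
a *₄ b = (toℕ a * toℕ b) mod 4

-₄_ : ℤ₄ → ℤ₄
-₄ a = (4 ∸ toℕ a) mod 4

_+₂_ : ℤ₂ → ℤ₂ → ℤ₂
a +₂ b = (toℕ a + toℕ b) mod 2

Word : ℕ → Set
Word n = Vec ℤ₄ n

_⊕_ : ∀ {n} → Word n → Word n → Word n
_⊕_ = zipWith _+₄_

_·_ : ∀ {n} → ℤ₄ → Word n → Word n
r · w = map (r *₄_) w

𝟎 : ∀ {n} → Word n
𝟎 = replicate _ zero

Subset4 : ℕ → Set
Subset4 n = Word n → Bool

record IsCode {n : ℕ} (C : Subset4 n) : Set where
  field
    zero-mem : C 𝟎 ≡ true
    add-mem  : ∀ u v → C u ≡ true → C v ≡ true → C (u ⊕ v) ≡ true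
    smul-mem : ∀ r u → C u ≡ true → C (r · u) ≡ true

Grp : ℕ → ℕ → Set
Grp k₁ k₂ = Vec ℤ₄ k₁ × Vec ℤ₂ k₂

_⊞_ : ∀ {k₁ k₂} → Grp k₁ k₂ → Grp k₁ k₂ → Grp k₁ k₂
(a , b) ⊞ (a' , b') = zipWith _+₄_ a a' , zipWith _+₂_ b b'

-- C has type 4^k₁ 2^k₂: C ≅ ℤ₄^k₁ × ℤ₂^k₂ as abelian groups, i.e. there is an
-- injective group homomorphism ℤ₄^k₁ × ℤ₂^k₂ → ℤ₄ⁿ whose image is exactly C
HasType : ∀ {n} → ℕ → ℕ → Subset4 n → Set
HasType {n} k₁ k₂ C =
  Σ (Grp k₁ k₂ → Word n) λ φ →
    (∀ x y → φ (x ⊞ y) ≡ φ x ⊕ φ y) ×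
    (∀ x y → φ x ≡ φ y → x ≡ y) ×
    (∀ w → (C w ≡ true) ⇔ (∃[ x ] φ x ≡ w))

act : ∀ {n} → Permutation′ n → (Fin n → Bool) → Word n → Word n
act σ ε w = tabulate λ i →
  if ε i then -₄ (lookup w (σ ⟨$⟩ʳ i)) else lookup w (σ ⟨$⟩ʳ i)

Equiv : ∀ {n} → Subset4 n → Subset4 n → Set
Equiv {n} C D = ∃[ σ ] ∃[ ε ] (∀ w → C w ≡ D (act {n} σ ε w))

TrivExt : ∀ {m} → Subset4 m → Subset4 (suc m) → Set
TrivExt {m} D C = ∀ w → (C w ≡ true) ⇔ ((last w ≡ zero) × (D (init w) ≡ true))

IsTrivExtClass : ∀ {m} → Subset4 (suc m) → Set
IsTrivExtClass {m} C =
  ∃[ D ] ∃[ E ] (IsCode {m} D × TrivExt D E × Equiv C E)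

Counted : ∀ n → ℕ → ℕ → Subset4 (suc n) → Set
Counted n k₁ k₂ C = IsCode C × HasType k₁ k₂ C × ¬ IsTrivExtClass C

-- "the number of equivalence classes of codes C with P C is exactly k":
-- there are k representatives, pairwise inequivalent, each satisfying P,
-- such that every code satisfying P is equivalent to one of them
NumClasses : ∀ {n} → (Subset4 n → Set) → ℕ → Set
NumClasses {n} P k =
  Σ (Fin k → Subset4 n) λ rep →
    (∀ i → P (rep i)) ×
    (∀ i j → Equiv (rep i) (rep j) → i ≡ j) ×
    (∀ C → P C → ∃[ i ] Equiv C (rep i))

-- N'(m+1, k₁, k₂) = k
N′≡ : ℕ → ℕ → ℕ → ℕ → Set
N′≡ m k₁ k₂ k = NumClasses (Counted m k₁ k₂) k

module Submission where

-- Write ρ : ℤ₄ → ℤ₂ for reduction mod 2.  For a binary "pattern" p ≠ 0 let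
-- C(p) = { w | ρ w ∈ {0, p} }, the preimage of the binary code {0, p}.
--   * C(p) is a code; if p₀ = 1 it has type 4¹2ⁿ⁻¹, generated by lift(p)
--     and the words 2eⱼ (j > 0).  It contains the all-two word, which every
--     monomial map fixes and whose last entry is nonzero, so C(p) is never
--     equivalent to a trivial extension.
--   * Conversely, let C ≅ ℤ₄ × ℤ₂ⁿ⁻¹.  The 2ⁿ elements of order ≤ 2 map
--     injectively onto even words; there are 2ⁿ even words, so C contains all
--     of them (injective endomaps of finite sets are surjective).  With g the
--     image of the generator of order 4 and p = ρ g one gets C = C(p), p ≠ 0.
--   * Permuting coordinates permutes the pattern, so C(p) ~ C(1ᵏ0ⁿ⁻ᵏ) with
--     k = weight p; and C(p) ~ C(q) forces q to be a rearrangement of p, so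
--     the weight is an invariant.  The n classes are C(1ᵏ0ⁿ⁻ᵏ), 1 ≤ k ≤ n.

open import Defs
open import Data.Nat using (ℕ; suc)

open import Data.Nat as ℕ using (zero; _≤_; z≤n; s≤s; _^_)
import Data.Nat.Properties as ℕP
open import Data.Fin as Fin using (Fin; toℕ; fromℕ<; zero; suc)
open import Data.Fin.Patterns using (0F; 1F; 2F; 3F)
import Data.Fin.Properties as FinP
open FinP using (all?; any?; _≟_)
open import Data.Fin.Permutation as Perm using (Permutation′; _⟨$⟩ʳ_; _⟨$⟩ˡ_; _∘ₚ_)
open import Data.Vec using (Vec; []; _∷_; zipWith; map; replicate; tabulate; lookup; last)
open import Data.Vec.Properties
  using (lookup-zipWith; lookup-map; lookup-replicate; lookup∘tabulate; tabulate∘lookup; tabulate-cong; zipWith-identityˡ)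
open import Data.Vec.Recursive using (Fin[m^n]↔Fin[m]^n)
open import Data.Vec.Recursive.Properties using (↔Vec)
open import Data.Bool using (Bool; true; false; if_then_else_)
open import Data.Bool.Properties using (¬-not)
open import Data.Product using (Σ; ∃; ∃-syntax; _×_; _,_; proj₁; proj₂)
open import Data.Sum using (_⊎_; inj₁; inj₂)
open import Data.Empty using (⊥-elim)
open import Function using (_∘_)
open import Function.Bundles using (_⇔_; mk⇔; Equivalence; _↔_; Inverse)
open import Function.Properties.Inverse using (↔-trans)
open import Relation.Binary.PropositionalEquality
  using (_≡_; _≢_; refl; sym; trans; cong; cong₂; subst; module ≡-Reasoning)
open import Relation.Nullary using (¬_; Dec; yes; no; does)
open import Relation.Nullary.Decidable using (True; toWitness; dec-true; does-⇔; _⊎-dec_; _→-dec_)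
open import Algebra.Properties.CommutativeMonoid.Sum ℕP.+-0-commutativeMonoid
  using (sum; sum-permute; sum-cong-≗)

open ≡-Reasoning

-- A statement about finitely many variables ranging over finite sets holds
-- once its decision procedure answers yes on every case; the implicit
-- argument is then the trivial proof, found by evaluation.
decide₁ : ∀ {k} {P : Fin k → Set} (P? : ∀ a → Dec (P a)) →
          {True (all? P?)} → ∀ a → P a
decide₁ P? {ok} = toWitness ok

decide₂ : ∀ {k l} {P : Fin k → Fin l → Set} (P? : ∀ a b → Dec (P a b)) →
          {True (all? λ a → all? λ b → P? a b)} → ∀ a b → P a b
decide₂ P? {ok} = toWitness ok

decide₃ : ∀ {k l m} {P : Fin k → Fin l → Fin m → Set} (P? : ∀ a b c → Dec (P a b c)) →
          {True (all? λ a → all? λ b → all? λ c → P? a b c)} → ∀ a b c → P a b c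
decide₃ P? {ok} = toWitness ok

decide₄ : ∀ {k l m n} {P : Fin k → Fin l → Fin m → Fin n → Set}
          (P? : ∀ a b c d → Dec (P a b c d)) →
          {True (all? λ a → all? λ b → all? λ c → all? λ d → P? a b c d)} →
          ∀ a b c d → P a b c d
decide₄ P? {ok} = toWitness ok

decide₅ : ∀ {k l m n o} {P : Fin k → Fin l → Fin m → Fin n → Fin o → Set}
          (P? : ∀ a b c d e → Dec (P a b c d e)) →
          {True (all? λ a → all? λ b → all? λ c → all? λ d → all? λ e → P? a b c d e)} →
          ∀ a b c d e → P a b c d e
decide₅ P? {ok} = toWitness ok

ρ : ℤ₄ → ℤ₂
ρ 0F = 0F
ρ 1F = 1F
ρ 2F = 0F
ρ 3F = 1F

infixl 7 _*₂_

_*₂_ : ℤ₂ → ℤ₂ → ℤ₂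
0F *₂ _ = 0F
1F *₂ s = s

-- the isomorphism ℤ₂ ≅ 2ℤ₄, c ↦ 2c, and its inverse on even elements
ι : ℤ₂ → ℤ₄
ι 0F = 0F
ι 1F = 2F

half : ℤ₄ → ℤ₂
half 0F = 0F
half 1F = 0F
half 2F = 1F
half 3F = 1F

lift : ℤ₂ → ℤ₄
lift 0F = 0F
lift 1F = 1F

signed : Bool → ℤ₄ → ℤ₄
signed b x = if b then -₄ x else x

ρ-+ : ∀ a b → ρ (a +₄ b) ≡ ρ a +₂ ρ b
ρ-+ = decide₂ λ _ _ → _ ≟ _

ρ-* : ∀ a b → ρ (a *₄ b) ≡ ρ a *₂ ρ b
ρ-* = decide₂ λ _ _ → _ ≟ _

ρ-signed : ∀ b x → ρ (signed b x) ≡ ρ x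
ρ-signed true  = decide₁ λ _ → _ ≟ _
ρ-signed false _ = refl

ρ-ι : ∀ c → ρ (ι c) ≡ 0F
ρ-ι = decide₁ λ _ → _ ≟ _

ρ-lift : ∀ s → ρ (lift s) ≡ s
ρ-lift = decide₁ λ _ → _ ≟ _

signed-two : ∀ b → signed b 2F ≡ 2F
signed-two true  = refl
signed-two false = refl

order-two-even : ∀ a → a +₄ a ≡ 0F → ρ a ≡ 0F
order-two-even = decide₁ λ _ → (_ ≟ _) →-dec (_ ≟ _)

even-order-two : ∀ a → ρ a ≡ 0F → a +₄ a ≡ 0F
even-order-two = decide₁ λ _ → (_ ≟ _) →-dec (_ ≟ _)

idempotent-zero : ∀ a → a ≡ a +₄ a → a ≡ 0F
idempotent-zero = decide₁ λ _ → (_ ≟ _) →-dec (_ ≟ _)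

ι-half : ∀ a → ρ a ≡ 0F → ι (half a) ≡ a
ι-half = decide₁ λ _ → (_ ≟ _) →-dec (_ ≟ _)

ι-injective : ∀ c c' → ι c ≡ ι c' → c ≡ c'
ι-injective = decide₂ λ _ _ → (_ ≟ _) →-dec (_ ≟ _)

+₂-identityˡ : ∀ s → 0F +₂ s ≡ s
+₂-identityˡ = decide₁ λ _ → _ ≟ _

+₂-identityʳ : ∀ s → s +₂ 0F ≡ s
+₂-identityʳ = decide₁ λ _ → _ ≟ _

+₂-self : ∀ s → s +₂ s ≡ 0F
+₂-self = decide₁ λ _ → _ ≟ _

*₂-identityʳ : ∀ s → s *₂ 1F ≡ s
*₂-identityʳ = decide₁ λ _ → _ ≟ _

≢1⇒≡0 : ∀ {s : ℤ₂} → s ≢ 1F → s ≡ 0F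
≢1⇒≡0 {0F} _    = refl
≢1⇒≡0 {1F} s≢1 = ⊥-elim (s≢1 refl)

-- w − g is even when w ≡ g mod 2, and g + (w − g) = w
difference-even : ∀ g w → ρ w ≡ ρ g → ρ (w +₄ (3F *₄ g)) ≡ 0F
difference-even = decide₂ λ _ _ → (_ ≟ _) →-dec (_ ≟ _)

add-difference : ∀ g w → g +₄ (w +₄ (3F *₄ g)) ≡ w
add-difference = decide₂ λ _ _ → _ ≟ _

-- One coordinate a·lift(s) + 2c of the word generated by a and 2c, where s is
-- the pattern bit of that coordinate.
κ : ℤ₂ → ℤ₄ → ℤ₂ → ℤ₄
κ s a c = (a *₄ lift s) +₄ ι c

κ-additive : ∀ s a a' c c' → κ s (a +₄ a') (c +₂ c') ≡ κ s a c +₄ κ s a' c'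
κ-additive = decide₅ λ _ _ _ _ _ → _ ≟ _

κ-cancel : ∀ s a c c' → κ s a c ≡ κ s a c' → c ≡ c'
κ-cancel = decide₄ λ _ _ _ _ → (_ ≟ _) →-dec (_ ≟ _)

ρ-κ : ∀ s a c → ρ (κ s a c) ≡ ρ a *₂ s
ρ-κ = decide₃ λ _ _ _ → _ ≟ _

κ-solve : ∀ s a w → ρ w ≡ ρ a *₂ s → κ s a (half (w +₄ (-₄ (a *₄ lift s)))) ≡ w
κ-solve = decide₃ λ _ _ _ → (_ ≟ _) →-dec (_ ≟ _)

does-true⇒ : ∀ {A : Set} (a? : Dec A) → does a? ≡ true → A
does-true⇒ (yes a) _ = a

≡does : ∀ {A : Set} {b : Bool} → (b ≡ true) ⇔ A → (a? : Dec A) → b ≡ does a?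
≡does b⇔A (yes a) = Equivalence.from b⇔A a
≡does b⇔A (no ¬a) = ¬-not (¬a ∘ Equivalence.to b⇔A)

lookup-ext : ∀ {A : Set} {n} {u v : Vec A n} → (∀ i → lookup u i ≡ lookup v i) → u ≡ v
lookup-ext {u = u} {v} same =
  trans (sym (tabulate∘lookup u)) (trans (tabulate-cong same) (tabulate∘lookup v))

last-replicate : ∀ {A : Set} n (x : A) → last (replicate (suc n) x) ≡ x
last-replicate zero    x = refl
last-replicate (suc n) x = last-replicate n x

zipWith-self : ∀ {k} (b : Vec ℤ₂ k) → zipWith _+₂_ b b ≡ replicate k 0F
zipWith-self []      = refl
zipWith-self (c ∷ b) = cong₂ _∷_ (+₂-self c) (zipWith-self b)

Fin-injective⇒surjective : ∀ {k} (f : Fin k → Fin k) → (∀ x y → f x ≡ f y → x ≡ y) →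
                           ∀ y → ∃[ x ] f x ≡ y
Fin-injective⇒surjective {k} f f-inj y with any? (λ x → f x ≟ y)
... | yes hit = hit
... | no miss = ⊥-elim (no-collision (FinP.pigeonhole (ℕP.n<1+n k) f+y))
  where
  f+y : Fin (suc k) → Fin k
  f+y zero    = y
  f+y (suc x) = f x
  no-collision : ¬ (∃ λ a → ∃ λ b → a Fin.< b × f+y a ≡ f+y b)
  no-collision (zero  , suc b , _   , y≡fb)  = miss (b , sym y≡fb)
  no-collision (suc a , suc b , a<b , fa≡fb) = FinP.<-irrefl (cong suc (f-inj a b fa≡fb)) a<b

injective⇒surjective : ∀ {A : Set} {k} → Fin k ↔ A → (f : A → A) →
                       (∀ x y → f x ≡ f y → x ≡ y) → ∀ y → ∃[ x ] f x ≡ y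
injective⇒surjective e f f-inj y =
  let x , hit = Fin-injective⇒surjective (from ∘ f ∘ to) transported-injective (from y)
  in to x , (begin
    f (to x)              ≡⟨ strictlyInverseˡ (f (to x)) ⟨
    to (from (f (to x)))  ≡⟨ cong to hit ⟩
    to (from y)           ≡⟨ strictlyInverseˡ y ⟩
    y                     ∎)
  where
  open Inverse e
  transported-injective : ∀ x x' → from (f (to x)) ≡ from (f (to x')) → x ≡ x'
  transported-injective x x' same = begin
    x             ≡⟨ strictlyInverseʳ x ⟨
    from (to x)   ≡⟨ cong from (f-inj (to x) (to x') (begin
      f (to x)               ≡⟨ strictlyInverseˡ (f (to x)) ⟨
      to (from (f (to x)))   ≡⟨ cong to same ⟩
      to (from (f (to x')))  ≡⟨ strictlyInverseˡ (f (to x')) ⟩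
      f (to x')              ∎)) ⟩
    from (to x')  ≡⟨ strictlyInverseʳ x' ⟩
    x'            ∎

binary-words : ∀ n → Fin (2 ^ n) ↔ Vec ℤ₂ n
binary-words n = ↔-trans (Fin[m^n]↔Fin[m]^n 2 n) (↔Vec n)

res : ∀ {n} → Word n → Fin n → ℤ₂
res w i = ρ (lookup w i)

Even : ∀ {n} → Word n → Set
Even w = ∀ i → res w i ≡ 0F

res-⊕ : ∀ {n} (u v : Word n) i → res (u ⊕ v) i ≡ res u i +₂ res v i
res-⊕ u v i = trans (cong ρ (lookup-zipWith _+₄_ i u v)) (ρ-+ (lookup u i) (lookup v i))

res-· : ∀ {n} r (u : Word n) i → res (r · u) i ≡ ρ r *₂ res u i
res-· r u i = trans (cong ρ (lookup-map i (r *₄_) u)) (ρ-* r (lookup u i))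

res-𝟎 : ∀ {n} → Even (𝟎 {n})
res-𝟎 i = cong ρ (lookup-replicate i 0F)

lookup-act : ∀ {n} σ ε (w : Word n) i → lookup (act σ ε w) i ≡ signed (ε i) (lookup w (σ ⟨$⟩ʳ i))
lookup-act σ ε w i = lookup∘tabulate (λ j → signed (ε j) (lookup w (σ ⟨$⟩ʳ j))) i

res-act : ∀ {n} σ ε (w : Word n) i → res (act σ ε w) i ≡ res w (σ ⟨$⟩ʳ i)
res-act σ ε w i = trans (cong ρ (lookup-act σ ε w i)) (ρ-signed (ε i) _)

double-half : ∀ {n} {w : Word n} → Even w → map ι (map half w) ≡ w
double-half {w = w} even = lookup-ext λ i → begin
  lookup (map ι (map half w)) i  ≡⟨ lookup-map i ι (map half w) ⟩
  ι (lookup (map half w) i)      ≡⟨ cong ι (lookup-map i half w) ⟩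
  ι (half (lookup w i))          ≡⟨ ι-half (lookup w i) (even i) ⟩
  lookup w i                     ∎

InSpan : ∀ {n} → (Fin n → ℤ₂) → (Fin n → ℤ₂) → Set
InSpan p v = (∀ i → v i ≡ 0F) ⊎ (∀ i → v i ≡ p i)

InSpan? : ∀ {n} (p v : Fin n → ℤ₂) → Dec (InSpan p v)
InSpan? p v = all? (λ i → v i ≟ 0F) ⊎-dec all? (λ i → v i ≟ p i)

InSpan-resp : ∀ {n} {p p' v v' : Fin n → ℤ₂} → (∀ i → p i ≡ p' i) → (∀ i → v i ≡ v' i) →
              InSpan p v → InSpan p' v'
InSpan-resp p≈p' v≈v' (inj₁ v≈0) = inj₁ λ i → trans (sym (v≈v' i)) (v≈0 i)
InSpan-resp p≈p' v≈v' (inj₂ v≈p) = inj₂ λ i → trans (sym (v≈v' i)) (trans (v≈p i) (p≈p' i))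

InSpan-reindex : ∀ {n} {p v : Fin n → ℤ₂} (f : Fin n → Fin n) → InSpan p v → InSpan (p ∘ f) (v ∘ f)
InSpan-reindex f (inj₁ v≈0) = inj₁ (v≈0 ∘ f)
InSpan-reindex f (inj₂ v≈p) = inj₂ (v≈p ∘ f)

InSpan-+ : ∀ {n} {p u v : Fin n → ℤ₂} → InSpan p u → InSpan p v → InSpan p (λ i → u i +₂ v i)
InSpan-+         (inj₁ u≈0) (inj₁ v≈0) = inj₁ λ i → cong₂ _+₂_ (u≈0 i) (v≈0 i)
InSpan-+ {p = p} (inj₁ u≈0) (inj₂ v≈p) = inj₂ λ i → trans (cong₂ _+₂_ (u≈0 i) (v≈p i)) (+₂-identityˡ (p i))
InSpan-+ {p = p} (inj₂ u≈p) (inj₁ v≈0) = inj₂ λ i → trans (cong₂ _+₂_ (u≈p i) (v≈0 i)) (+₂-identityʳ (p i))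
InSpan-+ {p = p} (inj₂ u≈p) (inj₂ v≈p) = inj₁ λ i → trans (cong₂ _+₂_ (u≈p i) (v≈p i)) (+₂-self (p i))

InSpan-scale : ∀ {n} {p v : Fin n → ℤ₂} s → InSpan p v → InSpan p (λ i → s *₂ v i)
InSpan-scale 0F _      = inj₁ λ _ → refl
InSpan-scale 1F v∈span = v∈span

InSpan-coefficient : ∀ {n} {p v : Fin n → ℤ₂} {i₀} → p i₀ ≡ 1F → InSpan p v →
                     ∀ i → v i ≡ v i₀ *₂ p i
InSpan-coefficient {p = p} {i₀ = i₀} _     (inj₁ v≈0) i = trans (v≈0 i) (sym (cong (_*₂ p i) (v≈0 i₀)))
InSpan-coefficient {p = p} {i₀ = i₀} pi₀≡1 (inj₂ v≈p) i = trans (v≈p i) (sym (cong (_*₂ p i) (trans (v≈p i₀) pi₀≡1)))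

-- The code C(p): words whose residue lies in {0, p}

code : ∀ {n} → (Fin n → ℤ₂) → Subset4 n
code p w = does (InSpan? p (res w))

code-sound : ∀ {n} (p : Fin n → ℤ₂) w → code p w ≡ true → InSpan p (res w)
code-sound p w = does-true⇒ (InSpan? p (res w))

code-complete : ∀ {n} (p : Fin n → ℤ₂) w → InSpan p (res w) → code p w ≡ true
code-complete p w = dec-true (InSpan? p (res w))

-- C(p) is a ℤ₄-code since ρ is a ring homomorphism and {0, p} a binary code
code-is-code : ∀ {n} (p : Fin n → ℤ₂) → IsCode (code p)
code-is-code p = record
  { zero-mem = code-complete p 𝟎 (inj₁ res-𝟎)
  ; add-mem  = λ u v u∈C v∈C → code-complete p (u ⊕ v) (InSpan-resp (λ _ → refl) (sym ∘ res-⊕ u v)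
                 (InSpan-+ (code-sound p u u∈C) (code-sound p v v∈C)))
  ; smul-mem = λ r u u∈C → code-complete p (r · u) (InSpan-resp (λ _ → refl) (sym ∘ res-· r u)
                 (InSpan-scale (ρ r) (code-sound p u u∈C)))
  }

code-permute : ∀ {n} {p q : Fin n → ℤ₂} (σ : Permutation′ n) → (∀ i → p (σ ⟨$⟩ʳ i) ≡ q i) →
               Equiv (code p) (code q)
code-permute {p = p} {q} σ pσ≈q = σ , no-signs , λ w →
  does-⇔ (mk⇔ (forward w) (backward w)) (InSpan? p (res w)) (InSpan? q (res (act σ no-signs w)))
  where
  no-signs : _ → Bool
  no-signs _ = false
  forward : ∀ w → InSpan p (res w) → InSpan q (res (act σ no-signs w))
  forward w = InSpan-resp pσ≈q (sym ∘ res-act σ no-signs w) ∘ InSpan-reindex (σ ⟨$⟩ʳ_)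
  backward : ∀ w → InSpan q (res (act σ no-signs w)) → InSpan p (res w)
  backward w = InSpan-resp
    (λ i → trans (sym (pσ≈q (σ ⟨$⟩ˡ i))) (cong p (Perm.inverseʳ σ)))
    (λ i → trans (res-act σ no-signs w (σ ⟨$⟩ˡ i)) (cong (res w) (Perm.inverseʳ σ)))
    ∘ InSpan-reindex (σ ⟨$⟩ˡ_)

lifted : ∀ {n} → (Fin n → ℤ₂) → Word n
lifted p = tabulate (lift ∘ p)

res-lifted : ∀ {n} (p : Fin n → ℤ₂) i → res (lifted p) i ≡ p i
res-lifted p i = trans (cong ρ (lookup∘tabulate (lift ∘ p) i)) (ρ-lift (p i))

-- conversely, an equivalence C(p) ~ C(q) with p ≠ 0 rearranges p into q:
-- it maps lift(p) to a word with residue p ∘ σ, which must be q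
equivalent-patterns : ∀ {n} {p q : Fin n → ℤ₂} {i₀} → p i₀ ≡ 1F → Equiv (code p) (code q) →
                      Σ (Permutation′ n) λ σ → ∀ i → p (σ ⟨$⟩ʳ i) ≡ q i
equivalent-patterns {p = p} {q} {i₀} pi₀≡1 (σ , ε , C≡D∘act)
  with code-sound q (act σ ε (lifted p)) (trans (sym (C≡D∘act (lifted p))) (code-complete p (lifted p) (inj₂ (res-lifted p))))
... | inj₁ pσ≈0 = ⊥-elim (0≢1 (begin
    0F                                     ≡⟨ pσ≈0 (σ ⟨$⟩ˡ i₀) ⟨
    res (act σ ε (lifted p)) (σ ⟨$⟩ˡ i₀)   ≡⟨ res-act σ ε (lifted p) (σ ⟨$⟩ˡ i₀) ⟩
    res (lifted p) (σ ⟨$⟩ʳ (σ ⟨$⟩ˡ i₀))    ≡⟨ cong (res (lifted p)) (Perm.inverseʳ σ) ⟩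
    res (lifted p) i₀                      ≡⟨ res-lifted p i₀ ⟩
    p i₀                                   ≡⟨ pi₀≡1 ⟩
    1F                                     ∎))
  where
  0≢1 : 0F ≢ 1F
  0≢1 ()
... | inj₂ pσ≈q = σ , λ i → begin
    p (σ ⟨$⟩ʳ i)                ≡⟨ res-lifted p (σ ⟨$⟩ʳ i) ⟨
    res (lifted p) (σ ⟨$⟩ʳ i)   ≡⟨ res-act σ ε (lifted p) i ⟨
    res (act σ ε (lifted p)) i  ≡⟨ pσ≈q i ⟩
    q i                         ∎

all-two : ∀ {n} → Word n
all-two = replicate _ 2F

-- monomial maps fix the all-two word, since −2 = 2
act-all-two : ∀ {n} σ ε → act {n} σ ε all-two ≡ all-two
act-all-two σ ε = lookup-ext λ i → begin
  lookup (act σ ε all-two) i               ≡⟨ lookup-act σ ε all-two i ⟩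
  signed (ε i) (lookup all-two (σ ⟨$⟩ʳ i))  ≡⟨ cong (signed (ε i)) (lookup-replicate (σ ⟨$⟩ʳ i) 2F) ⟩
  signed (ε i) 2F                          ≡⟨ signed-two (ε i) ⟩
  2F                                       ≡⟨ lookup-replicate i 2F ⟨
  lookup all-two i                         ∎

-- A code containing the all-two word is not equivalent to a trivial
-- extension: the equivalence fixes that word, whose last entry is not 0.
all-two-not-trivial : ∀ {m} (C : Subset4 (suc m)) → C all-two ≡ true → ¬ IsTrivExtClass C
all-two-not-trivial {m} C two∈C (D , E , _ , E-trivial , σ , ε , C≡E∘act) = 2≢0 (begin
  2F                           ≡⟨ last-replicate m 2F ⟨
  last (all-two {suc m})       ≡⟨ cong last (act-all-two σ ε) ⟨
  last (act σ ε all-two)       ≡⟨ proj₁ (Equivalence.to (E-trivial (act σ ε all-two)) two∈E) ⟩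
  zero                         ∎)
  where
  two∈E : E (act σ ε all-two) ≡ true
  two∈E = trans (sym (C≡E∘act all-two)) two∈C
  2≢0 : 2F ≢ zero {3}
  2≢0 ()

code-contains-all-two : ∀ {n} (p : Fin n → ℤ₂) → code p all-two ≡ true
code-contains-all-two p = code-complete p all-two (inj₁ λ i → cong ρ (lookup-replicate i 2F))

weight : ∀ {n} → (Fin n → ℤ₂) → ℕ
weight p = sum (toℕ ∘ p)

ones : ∀ {n} → ℕ → Fin n → ℤ₂
ones zero    _       = 0F
ones (suc k) zero    = 1F
ones (suc k) (suc i) = ones k i

weight-ones : ∀ {n} k → k ≤ n → weight (ones {n} k) ≡ k
weight-ones {zero}  zero    _         = refl
weight-ones {suc n} zero    _         = weight-ones {n} zero z≤n
weight-ones {suc n} (suc k) (s≤s k≤n) = cong suc (weight-ones k k≤n)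

-- Every pattern can be rearranged into normal form: move a one (if any) to
-- the front, then normalise the remaining coordinates.
normalise : ∀ {n} (p : Fin n → ℤ₂) →
            ∃[ k ] k ≤ n × Σ (Permutation′ n) λ σ → ∀ i → p (σ ⟨$⟩ʳ i) ≡ ones k i
normalise {zero} p = 0 , z≤n , Perm.id , λ ()
normalise {suc n} p with any? (λ j → p j ≟ 1F)
... | no no-one = 0 , z≤n , Perm.id , λ i → ≢1⇒≡0 (no-one ∘ (i ,_))
... | yes (j , pj≡1) with normalise (λ i → p (Perm.transpose zero j ⟨$⟩ʳ suc i))
...   | k , k≤n , τ , rest = suc k , s≤s k≤n , Perm.lift₀ τ ∘ₚ Perm.transpose zero j , λ
  { zero    → pj≡1
  ; (suc i) → rest i }

module StandardGenerator {m : ℕ} (p : Fin (suc m) → ℤ₂) (p₀≡1 : p zero ≡ 1F) where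

  encode : Grp 1 m → Word (suc m)
  encode (a ∷ [] , b) = a ∷ tabulate λ j → κ (p (suc j)) a (lookup b j)

  lookup-encode : ∀ a b j → lookup (encode (a ∷ [] , b)) (suc j) ≡ κ (p (suc j)) a (lookup b j)
  lookup-encode a b j = lookup∘tabulate (λ j → κ (p (suc j)) a (lookup b j)) j

  encode-additive : ∀ x y → encode (x ⊞ y) ≡ encode x ⊕ encode y
  encode-additive x@(a ∷ [] , b) y@(a' ∷ [] , b') = lookup-ext λ
    { zero    → refl
    ; (suc j) → begin
        lookup (encode (x ⊞ y)) (suc j)
          ≡⟨ lookup-encode (a +₄ a') (zipWith _+₂_ b b') j ⟩
        κ (p (suc j)) (a +₄ a') (lookup (zipWith _+₂_ b b') j)
          ≡⟨ cong (κ (p (suc j)) (a +₄ a')) (lookup-zipWith _+₂_ j b b') ⟩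
        κ (p (suc j)) (a +₄ a') (lookup b j +₂ lookup b' j)
          ≡⟨ κ-additive (p (suc j)) a a' (lookup b j) (lookup b' j) ⟩
        κ (p (suc j)) a (lookup b j) +₄ κ (p (suc j)) a' (lookup b' j)
          ≡⟨ cong₂ _+₄_ (lookup-encode a b j) (lookup-encode a' b' j) ⟨
        lookup (encode x) (suc j) +₄ lookup (encode y) (suc j)
          ≡⟨ lookup-zipWith _+₄_ (suc j) (encode x) (encode y) ⟨
        lookup (encode x ⊕ encode y) (suc j)
          ∎ }

  -- the first coordinate recovers a, and then each κ-coordinate recovers b
  encode-injective : ∀ x y → encode x ≡ encode y → x ≡ y
  encode-injective (a ∷ [] , b) (a' ∷ [] , b') same with cong (λ w → lookup w zero) same
  ... | refl = cong (a ∷ [] ,_) (lookup-ext λ j → κ-cancel (p (suc j)) a _ _ (begin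
    κ (p (suc j)) a (lookup b j)    ≡⟨ lookup-encode a b j ⟨
    lookup (encode (a ∷ [] , b)) (suc j)    ≡⟨ cong (λ w → lookup w (suc j)) same ⟩
    lookup (encode (a ∷ [] , b')) (suc j)   ≡⟨ lookup-encode a b' j ⟩
    κ (p (suc j)) a (lookup b' j)   ∎))

  res-encode : ∀ a b i → res (encode (a ∷ [] , b)) i ≡ ρ a *₂ p i
  res-encode a b zero    = sym (trans (cong (ρ a *₂_) p₀≡1) (*₂-identityʳ (ρ a)))
  res-encode a b (suc j) = trans (cong ρ (lookup-encode a b j)) (ρ-κ (p (suc j)) a (lookup b j))

  encode-image⊆code : ∀ x → code p (encode x) ≡ true
  encode-image⊆code (a ∷ [] , b) = code-complete p (encode (a ∷ [] , b))
    (InSpan-resp (λ _ → refl) (sym ∘ res-encode a b) (InSpan-scale (ρ a) (inj₂ λ _ → refl)))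

  -- a word of C(p) is encode (w₀, b) with bⱼ = (wⱼ₊₁ − w₀ · lift pⱼ₊₁) / 2
  code⊆encode-image : ∀ w → code p w ≡ true → ∃[ x ] encode x ≡ w
  code⊆encode-image (w₀ ∷ ws) w∈C = (w₀ ∷ [] , b) , cong (w₀ ∷_) (lookup-ext λ j → begin
      lookup (tabulate λ j → κ (p (suc j)) w₀ (lookup b j)) j
        ≡⟨ lookup-encode w₀ b j ⟩
      κ (p (suc j)) w₀ (lookup b j)
        ≡⟨ cong (κ (p (suc j)) w₀) (lookup∘tabulate (λ j → half (difference j)) j) ⟩
      κ (p (suc j)) w₀ (half (difference j))
        ≡⟨ κ-solve (p (suc j)) w₀ (lookup ws j)
             (InSpan-coefficient p₀≡1 (code-sound p (w₀ ∷ ws) w∈C) (suc j)) ⟩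
      lookup ws j
        ∎)
    where
    difference : Fin m → ℤ₄
    difference j = lookup ws j +₄ (-₄ (w₀ *₄ lift (p (suc j))))
    b : Vec ℤ₂ m
    b = tabulate λ j → half (difference j)

  has-type : HasType 1 m (code p)
  has-type = encode , encode-additive , encode-injective , λ w →
    mk⇔ (code⊆encode-image w) λ { (x , refl) → encode-image⊆code x }

0ᴳ : ∀ {m} → Grp 1 m
0ᴳ = 0F ∷ [] , replicate _ 0F

unit : ∀ {m} → Grp 1 m
unit = 1F ∷ [] , replicate _ 0F

OrderTwo : ∀ {m} → Grp 1 m → Set
OrderTwo x = x ⊞ x ≡ 0ᴳ

order-two-of-even : ∀ {m} a (b : Vec ℤ₂ m) → ρ a ≡ 0F → OrderTwo (a ∷ [] , b)
order-two-of-even a b even = cong₂ (λ a' b' → a' ∷ [] , b') (even-order-two a even) (zipWith-self b)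

decompose : ∀ {m} (x : Grp 1 m) → OrderTwo x ⊎ ∃[ y ] OrderTwo y × x ≡ unit ⊞ y
decompose (0F ∷ [] , b) = inj₁ (order-two-of-even 0F b refl)
decompose (1F ∷ [] , b) = inj₂ ((0F ∷ [] , b) , order-two-of-even 0F b refl ,
                                cong (1F ∷ [] ,_) (sym (zipWith-identityˡ +₂-identityˡ b)))
decompose (2F ∷ [] , b) = inj₁ (order-two-of-even 2F b refl)
decompose (3F ∷ [] , b) = inj₂ ((2F ∷ [] , b) , order-two-of-even 2F b refl ,
                                cong (3F ∷ [] ,_) (sym (zipWith-identityˡ +₂-identityˡ b)))

two-torsion : ∀ {m} → Vec ℤ₂ (suc m) → Grp 1 m
two-torsion (c ∷ b) = ι c ∷ [] , b

two-torsion-order-two : ∀ {m} (x : Vec ℤ₂ (suc m)) → OrderTwo (two-torsion x)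
two-torsion-order-two (c ∷ b) = order-two-of-even (ι c) b (ρ-ι c)

two-torsion-injective : ∀ {m} (x y : Vec ℤ₂ (suc m)) → two-torsion x ≡ two-torsion y → x ≡ y
two-torsion-injective (c ∷ b) (c' ∷ b') same =
  cong₂ _∷_ (ι-injective c c' (cong (λ x → lookup (proj₁ x) zero) same)) (cong proj₂ same)

-- Every code of type 4¹2ᵐ is some C(p), and hence equivalent to a C(1ᵏ0ᵐ⁺¹⁻ᵏ)

-- the representative codes C(1ᵏ0ᵐ⁺¹⁻ᵏ), k = i + 1
representative : ∀ {m} → Fin (suc m) → Subset4 (suc m)
representative i = code (ones (suc (toℕ i)))

Equiv-respˡ : ∀ {n} {C D E : Subset4 n} → (∀ w → C w ≡ D w) → Equiv D E → Equiv C E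
Equiv-respˡ C≡D (σ , ε , D≡E∘act) = σ , ε , λ w → trans (C≡D w) (D≡E∘act w)

module Classification {m : ℕ} (C : Subset4 (suc m)) (C-code : IsCode C) (C-type : HasType 1 m C) where
  open IsCode C-code

  φ : Grp 1 m → Word (suc m)
  φ = proj₁ C-type

  φ-additive : ∀ x y → φ (x ⊞ y) ≡ φ x ⊕ φ y
  φ-additive = proj₁ (proj₂ C-type)

  φ-injective : ∀ x y → φ x ≡ φ y → x ≡ y
  φ-injective = proj₁ (proj₂ (proj₂ C-type))

  φ-image : ∀ w → (C w ≡ true) ⇔ (∃[ x ] φ x ≡ w)
  φ-image = proj₂ (proj₂ (proj₂ C-type))

  lookup-φ-⊞ : ∀ x y i → lookup (φ (x ⊞ y)) i ≡ lookup (φ x) i +₄ lookup (φ y) i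
  lookup-φ-⊞ x y i = trans (cong (λ w → lookup w i) (φ-additive x y)) (lookup-zipWith _+₄_ i (φ x) (φ y))

  -- φ 0 is idempotent, hence zero
  φ-zero : φ 0ᴳ ≡ 𝟎
  φ-zero = lookup-ext λ i → trans
    (idempotent-zero _ (begin
      lookup (φ 0ᴳ) i                       ≡⟨ cong (λ x → lookup (φ x) i) (order-two-of-even 0F (replicate m 0F) refl) ⟨
      lookup (φ (0ᴳ ⊞ 0ᴳ)) i                ≡⟨ lookup-φ-⊞ 0ᴳ 0ᴳ i ⟩
      lookup (φ 0ᴳ) i +₄ lookup (φ 0ᴳ) i    ∎))
    (sym (lookup-replicate i 0F))

  φ-order-two : ∀ x → OrderTwo x → Even (φ x)
  φ-order-two x x⊞x≡0 i = order-two-even _ (begin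
    lookup (φ x) i +₄ lookup (φ x) i   ≡⟨ lookup-φ-⊞ x x i ⟨
    lookup (φ (x ⊞ x)) i               ≡⟨ cong (λ y → lookup (φ y) i) x⊞x≡0 ⟩
    lookup (φ 0ᴳ) i                    ≡⟨ cong (λ w → lookup w i) φ-zero ⟩
    lookup 𝟎 i                          ≡⟨ lookup-replicate i 0F ⟩
    0F                                 ∎)

  -- C ∩ 2ℤ₄ⁿ, halved, as the image of an injective endomap of ℤ₂ᵐ⁺¹
  halves : Vec ℤ₂ (suc m) → Vec ℤ₂ (suc m)
  halves x = map half (φ (two-torsion x))

  double-halves : ∀ x → map ι (halves x) ≡ φ (two-torsion x)
  double-halves x = double-half (φ-order-two (two-torsion x) (two-torsion-order-two x))

  halves-injective : ∀ x y → halves x ≡ halves y → x ≡ y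
  halves-injective x y same = two-torsion-injective x y (φ-injective _ _ (begin
    φ (two-torsion x)   ≡⟨ double-halves x ⟨
    map ι (halves x)    ≡⟨ cong (map ι) same ⟩
    map ι (halves y)    ≡⟨ double-halves y ⟩
    φ (two-torsion y)   ∎))

  even⊆C : ∀ w → Even w → C w ≡ true
  even⊆C w even with injective⇒surjective (binary-words (suc m)) halves halves-injective (map half w)
  ... | x , halves-x≡ = Equivalence.from (φ-image w) (two-torsion x , (begin
    φ (two-torsion x)     ≡⟨ double-halves x ⟨
    map ι (halves x)      ≡⟨ cong (map ι) halves-x≡ ⟩
    map ι (map half w)    ≡⟨ double-half even ⟩
    w                     ∎))

  g : Word (suc m)
  g = φ unit

  p : Fin (suc m) → ℤ₂
  p = res g

  φ-in-span : ∀ x → InSpan p (res (φ x))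
  φ-in-span x with decompose x
  ... | inj₁ x-order-two = inj₁ (φ-order-two x x-order-two)
  ... | inj₂ (y , y-order-two , refl) = inj₂ λ i → begin
    res (φ (unit ⊞ y)) i            ≡⟨ cong ρ (lookup-φ-⊞ unit y i) ⟩
    ρ (lookup g i +₄ lookup (φ y) i) ≡⟨ ρ-+ (lookup g i) (lookup (φ y) i) ⟩
    p i +₂ res (φ y) i              ≡⟨ cong (p i +₂_) (φ-order-two y y-order-two i) ⟩
    p i +₂ 0F                       ≡⟨ +₂-identityʳ (p i) ⟩
    p i                             ∎

  C⊆code : ∀ w → C w ≡ true → InSpan p (res w)
  C⊆code w w∈C with Equivalence.to (φ-image w) w∈C
  ... | x , refl = φ-in-span x

  -- a word with residue p is g plus the even word w − g
  code⊆C : ∀ w → InSpan p (res w) → C w ≡ true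
  code⊆C w (inj₁ w-even) = even⊆C w w-even
  code⊆C w (inj₂ w≈p)    = subst (λ v → C v ≡ true) g+u≡w (add-mem g u g∈C (even⊆C u u-even))
    where
    u : Word (suc m)
    u = w ⊕ (3F · g)
    lookup-u : ∀ i → lookup u i ≡ lookup w i +₄ (3F *₄ lookup g i)
    lookup-u i = trans (lookup-zipWith _+₄_ i w (3F · g)) (cong (lookup w i +₄_) (lookup-map i (3F *₄_) g))
    u-even : Even u
    u-even i = trans (cong ρ (lookup-u i)) (difference-even (lookup g i) (lookup w i) (w≈p i))
    g+u≡w : g ⊕ u ≡ w
    g+u≡w = lookup-ext λ i → trans (lookup-zipWith _+₄_ i g u)
      (trans (cong (lookup g i +₄_) (lookup-u i)) (add-difference (lookup g i) (lookup w i)))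
    g∈C : C g ≡ true
    g∈C = Equivalence.from (φ-image g) (unit , refl)

  C≡code : ∀ w → C w ≡ code p w
  C≡code w = ≡does (mk⇔ (C⊆code w) (code⊆C w)) (InSpan? p (res w))

  -- p ≠ 0, otherwise g + g = 0 and the generator would have order 2
  pattern-nonzero : ¬ (∀ i → p i ≡ 0F)
  pattern-nonzero p≈0 with φ-injective (unit ⊞ unit) 0ᴳ (trans (φ-additive unit unit) (trans g+g≡0 (sym φ-zero)))
    where
    g+g≡0 : g ⊕ g ≡ 𝟎
    g+g≡0 = lookup-ext λ i → trans (lookup-zipWith _+₄_ i g g)
      (trans (even-order-two (lookup g i) (p≈0 i)) (sym (lookup-replicate i 0F)))
  ... | ()

  -- C = C(p) ~ C(1ᵏ0ᵐ⁺¹⁻ᵏ) by normalising p; k ≠ 0 since p ≠ 0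
  classify : ∃[ i ] Equiv C (representative i)
  classify with normalise p
  ... | zero , _ , σ , pσ≈0 = ⊥-elim (pattern-nonzero λ i →
          trans (cong p (sym (Perm.inverseʳ σ))) (pσ≈0 (σ ⟨$⟩ˡ i)))
  ... | suc k , k<n , σ , pσ≈ones =
    fromℕ< k<n , Equiv-respˡ {E = representative (fromℕ< k<n)} C≡code (code-permute {p = p} σ λ i →
      trans (pσ≈ones i) (cong (λ k → ones (suc k) i) (sym (FinP.toℕ-fromℕ< k<n))))

-- The representatives are pairwise inequivalent: the weight is invariant

representatives-inequivalent : ∀ {m} (i j : Fin (suc m)) →
                               Equiv (representative i) (representative j) → i ≡ j
representatives-inequivalent {m} i j i~j
  with equivalent-patterns {p = ones (suc (toℕ i))} {q = ones (suc (toℕ j))} {i₀ = zero} refl i~j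
... | σ , pσ≈q = FinP.toℕ-injective (ℕP.suc-injective (begin
  suc (toℕ i)                       ≡⟨ weight-ones {suc m} (suc (toℕ i)) (FinP.toℕ<n i) ⟨
  weight p                          ≡⟨ sum-permute (toℕ ∘ p) σ ⟩
  weight (λ t → p (σ ⟨$⟩ʳ t))       ≡⟨ sum-cong-≗ (cong toℕ ∘ pσ≈q) ⟩
  weight (ones {suc m} (suc (toℕ j))) ≡⟨ weight-ones {suc m} (suc (toℕ j)) (FinP.toℕ<n j) ⟩
  suc (toℕ j)                       ∎))
  where
  p : Fin _ → ℤ₂
  p = ones (suc (toℕ i))

representative-counted : ∀ {m} (i : Fin (suc m)) → Counted m 1 m (representative i)
representative-counted i =
  code-is-code p , StandardGenerator.has-type p refl , all-two-not-trivial (code p) (code-contains-all-two p)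
  where
  p : Fin _ → ℤ₂
  p = ones (suc (toℕ i))

proposition4p3 : (m : ℕ) → N′≡ m 1 m (suc m)
proposition4p3 m =
    representative
  , representative-counted
  , representatives-inequivalent
  , λ C (C-code , C-type , _) → Classification.classify C C-code C-type
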